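{- Let $k\ge 1$ and $\mathbf a=(a_1,\dots,a_k)\in\mathbb N^k$ (with $\mathbb N=\{0,1,2,\dots\}$). Put $M_{\mathbf a}:=M_{a_1}M_{a_2}\cdots M_{a_k}$ where $M_a=\begin{pmatrix}0&1\\ 2^a&2^a\end{pmatrix}$, and let $h:=h_{a_1}\circ h_{a_2}\circ\cdots\circ h_{a_k}$ where $h_a(x)=\dfrac{2^{ -a}}{1+x}$. Define the continuant pair $(P,Q)$ by $(P,Q)^T:=M_{\mathbf a}(0,1)^T$, let $g(P,Q):=\gcd(P,Q)$, $R(P,Q):=Q/\gcd(P,Q)$, and $d(h):=|\det M_{\mathbf a}|=2^{a_1+\cdots+a_k}$. Then $$Q^{ -2}=\frac{|h'(0)|}{d(h)},\qquad |Q|_2^{ -2}=d(h)\,|h'(0)|_2,$$ $$R(P,Q)^{ -2}=|h'(0)|\,|h'(0)|_2\,G_2(h(0)),\qquad g(P,Q)^2=d(h)\,|h'(0)|_2\,G_2(h(0)),$$ where $h(0)$ and $h'(0)$ are rational numbers.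
   Context: For an integer $n\neq 0$, $\delta(n)$ denotes the largest $k$ with $2^k\mid n$; the dyadic absolute value on $\mathbb Q$ is $|a/b|_2:=2^{\delta(b)-\delta(a)}$ (and $|0|_2=0$). The function $G_2:\mathbb Q_2\to\mathbb R^+$ is $G_2(y)=\min(1,|y|_2^{ -2})$, i.e. $G_2(y)=1$ if $|y|_2\le 1$ and $G_2(y)=|y|_2^{ -2}$ if $|y|_2>1$. $|\cdot|$ is the usual real absolute value. -}

module Defs where

open import Data.Bool using (if_then_else_)
open import Data.Nat as ℕ using (ℕ; zero; suc)
import Data.Nat.DivMod as ℕD
open import Data.Integer as ℤ using (ℤ; +_; -[1+_])
open import Data.Integer.GCD as ℤG using ()
open import Data.Rational as ℚ using (ℚ; mkℚ; 0ℚ; 1ℚ; _+_; _*_; -_; _≤ᵇ_)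
open import Data.Rational.Properties as ℚP using ()
open import Data.Vec using (Vec; []; _∷_)
open import Relation.Nullary using (yes; no)

ℤ→ℚ : ℤ → ℚ
ℤ→ℚ z = z ℚ./ 1

-- total multiplicative inverse on ℚ (inv 0 = 0); only ever applied to
-- nonzero arguments in the statement.
inv : ℚ → ℚ
inv p with p ℚP.≟ 0ℚ
... | yes _  = 0ℚ
... | no p≢0 = ℚ.1/_ p {{ℚ.≢-nonZero p≢0}}

pow2 : ℤ → ℚ
pow2 (+ n)     = ℤ→ℚ (+ (2 ℕ.^ n))
pow2 -[1+ n ]  = inv (ℤ→ℚ (+ (2 ℕ.^ suc n)))

sq : ℚ → ℚ
sq p = p * p

-- δ(n): the largest k with 2^k ∣ n (for n ≠ 0).
-- Computed by repeated halving; the fuel n is always enough since δ(n) ≤ n.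
δ-fuel : ℕ → ℕ → ℕ
δ-fuel zero    n       = 0
δ-fuel (suc f) zero    = 0
δ-fuel (suc f) (suc m) with suc m ℕD.% 2
... | zero  = suc (δ-fuel f (suc m ℕD./ 2))
... | suc _ = 0

δ : ℕ → ℕ
δ n = δ-fuel n n

-- dyadic absolute value |a/b|₂ = 2^(δ(b) - δ(a)), |0|₂ = 0
-- (computed on the reduced representative; the value is independent of it)
abs₂ : ℚ → ℚ
abs₂ p with ℚ.↥ p
... | + zero = 0ℚ
... | a      = pow2 (+ δ (ℚ.↧ₙ p) ℤ.- + δ ℤ.∣ a ∣)

G₂ : ℚ → ℚ
G₂ y = if abs₂ y ≤ᵇ 1ℚ then 1ℚ else inv (sq (abs₂ y))

record Mat2 : Set where
  constructor mat
  field
    m11 m12 m21 m22 : ℤ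
open Mat2 public

_⊗_ : Mat2 → Mat2 → Mat2
mat a b c d ⊗ mat e f g h =
  mat (a ℤ.* e ℤ.+ b ℤ.* g) (a ℤ.* f ℤ.+ b ℤ.* h)
      (c ℤ.* e ℤ.+ d ℤ.* g) (c ℤ.* f ℤ.+ d ℤ.* h)

I₂ : Mat2
I₂ = mat (+ 1) (+ 0) (+ 0) (+ 1)

det : Mat2 → ℤ
det (mat a b c d) = a ℤ.* d ℤ.- b ℤ.* c

M : ℕ → Mat2
M a = mat (+ 0) (+ 1) (+ (2 ℕ.^ a)) (+ (2 ℕ.^ a))

Mvec : ∀ {k} → Vec ℕ k → Mat2
Mvec []       = I₂
Mvec (a ∷ as) = M a ⊗ Mvec as

-- continuant pair (P,Q)ᵀ = M_𝐚 (0,1)ᵀ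
P : ∀ {k} → Vec ℕ k → ℤ
P as = m12 (Mvec as)

Q : ∀ {k} → Vec ℕ k → ℤ
Q as = m22 (Mvec as)

g : ℤ → ℤ → ℤ
g = ℤG.gcd

R : ℤ → ℤ → ℚ
R p q = ℤ→ℚ q * inv (ℤ→ℚ (g p q))

d : ∀ {k} → Vec ℕ k → ℚ
d as = ℤ→ℚ (+ ℤ.∣ det (Mvec as) ∣)

-- Dual numbers ℚ[ε]/(ε²): exact first-order (automatic) differentiation
-- of rational functions.  f'(x₀) = ε-part of f(x₀ + ε).

record Dual : Set where
  constructor dual
  field
    val der : ℚ
open Dual public

_+D_ : Dual → Dual → Dual
dual u u' +D dual v v' = dual (u + v) (u' + v')

_*D_ : Dual → Dual → Dual
dual u u' *D dual v v' = dual (u * v) (u * v' + u' * v)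

invD : Dual → Dual
invD (dual u u') = dual (inv u) (- (u' * inv (sq u)))

constD : ℚ → Dual
constD c = dual c 0ℚ

hₐ : ℕ → Dual → Dual
hₐ a x = constD (pow2 (ℤ.- (+ a))) *D invD (constD 1ℚ +D x)

hvec : ∀ {k} → Vec ℕ k → Dual → Dual
hvec []       x = x
hvec (a ∷ as) x = hₐ a (hvec as x)

h0 : ∀ {k} → Vec ℕ k → ℚ
h0 as = val (hvec as (dual 0ℚ 1ℚ))

h'0 : ∀ {k} → Vec ℕ k → ℚ
h'0 as = der (hvec as (dual 0ℚ 1ℚ))

-- Composition of the h_a mirrors the matrix product: h is the Möbius map
-- x ↦ (A x + P)/(C x + Q) of M_𝐚 = [[A,P],[C,Q]], so h(0) = P/Q and
-- h'(0) = det M_𝐚 / Q², where |det M_𝐚| = 2^(a₁+⋯+a_k) by multiplicativity.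
-- As gcd(P,Q) divides det M_𝐚 = AQ - PC it is a power of two, namely
-- 2^min(δP,δQ). With |Q|₂ = 2^-δQ, |h'(0)|₂ = 2^(2δQ) / d(h) and
-- G₂(h(0)) = (gcd(P,Q) / 2^δQ)², the four identities become equalities
-- between products of fractions of naturals.
module Submission where

open import Defs

module Valuation where

  open import Data.Nat
  open import Data.Nat.Properties
  open import Data.Nat.DivMod using (m*n%n≡0; m*n/n≡m)
  open import Data.Nat.Divisibility
  open import Data.Nat.GCD using (gcd; gcd[m,n]∣m; gcd[m,n]∣n; gcd-greatest; gcd[m,n]≢0)
  open import Data.Nat.Coprimality using (Coprime; coprime-divisor)
  open import Data.Nat.Primality using (prime[2]; euclidsLemma; prime⇒irreducible)
  open import Data.Nat.Induction using (<-wellFounded)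
  open import Algebra.Properties.CommutativeSemigroup *-commutativeSemigroup using (interchange)
  open import Induction.WellFounded using (Acc; acc)
  open import Data.Product using (∃; ∃₂; _×_; _,_)
  open import Data.Sum using (inj₁; inj₂; [_,_]′)
  open import Function using (_∘_)
  open import Relation.Binary.PropositionalEquality
  open import Relation.Nullary using (yes; no; contradiction)

  Odd : ℕ → Set
  Odd n = 2 ∤ n

  odd⇒nonZero : ∀ {n} → Odd n → NonZero n
  odd⇒nonZero {zero}  odd = contradiction (2 ∣0) odd
  odd⇒nonZero {suc n} _   = _

  odd*odd⇒odd : ∀ {m n} → Odd m → Odd n → Odd (m * n)
  odd*odd⇒odd odd-m odd-n 2∣mn = [ odd-m , odd-n ]′ (euclidsLemma _ _ prime[2] 2∣mn)

  odd⇒coprime-2 : ∀ {n} → Odd n → Coprime n 2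
  odd⇒coprime-2 odd (i∣n , i∣2) with prime⇒irreducible prime[2] i∣2
  ... | inj₁ i≡1 = i≡1
  ... | inj₂ refl = contradiction i∣n odd

  odd∣2^n⇒≡1 : ∀ {o} n → Odd o → o ∣ 2 ^ n → o ≡ 1
  odd∣2^n⇒≡1 zero    _   o∣1 = ∣1⇒≡1 o∣1
  odd∣2^n⇒≡1 (suc n) odd o∣2^[1+n] = odd∣2^n⇒≡1 n odd (coprime-divisor (odd⇒coprime-2 odd) o∣2^[1+n])

  n<2^n : ∀ n → n < 2 ^ n
  n<2^n zero    = s≤s z≤n
  n<2^n (suc n) = +-mono-≤-< (m^n>0 2 n) (subst (n <_) (sym (+-identityʳ (2 ^ n))) (n<2^n n))

  ^-monoʳ-∣ : ∀ m {a b} → a ≤ b → m ^ a ∣ m ^ b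
  ^-monoʳ-∣ m {a} {b} a≤b = divides (m ^ (b ∸ a)) (begin
    m ^ b                ≡⟨ cong (m ^_) (sym (m∸n+n≡m a≤b)) ⟩
    m ^ (b ∸ a + a)      ≡⟨ ^-distribˡ-+-* m (b ∸ a) a ⟩
    m ^ (b ∸ a) * m ^ a  ∎)
    where open ≡-Reasoning

  δ-fuel-odd : ∀ f n → Odd n → δ-fuel (suc f) n ≡ 0
  δ-fuel-odd f zero    odd = contradiction (2 ∣0) odd
  δ-fuel-odd f (suc m) odd with suc m % 2 in eq
  ... | zero  = contradiction (m%n≡0⇒n∣m (suc m) 2 eq) odd
  ... | suc _ = refl

  δ-fuel-double : ∀ f n .{{_ : NonZero n}} → δ-fuel (suc f) (2 * n) ≡ suc (δ-fuel f n)
  δ-fuel-double f n@(suc _) with 2 * n % 2 in eq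
  ... | zero  = cong (suc ∘ δ-fuel f) (trans (cong (_/ 2) (*-comm 2 n)) (m*n/n≡m n 2))
  ... | suc _ = contradiction (trans (sym eq) (trans (cong (_% 2) (*-comm 2 n)) (m*n%n≡0 n 2))) λ ()

  δ-fuel-2^k*odd : ∀ f k {o} → Odd o → k < f → δ-fuel f (2 ^ k * o) ≡ k
  δ-fuel-2^k*odd (suc f) zero    {o} odd _ = δ-fuel-odd f (1 * o) (odd ∘ subst (2 ∣_) (*-identityˡ o))
  δ-fuel-2^k*odd (suc f) (suc k) {o} odd (s≤s k<f) = begin
    δ-fuel (suc f) (2 * 2 ^ k * o)    ≡⟨ cong (δ-fuel (suc f)) (*-assoc 2 (2 ^ k) o) ⟩
    δ-fuel (suc f) (2 * (2 ^ k * o))  ≡⟨ δ-fuel-double f (2 ^ k * o) {{m*n≢0 _ _ {{m^n≢0 2 k}} {{odd⇒nonZero odd}}}} ⟩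
    suc (δ-fuel f (2 ^ k * o))        ≡⟨ cong suc (δ-fuel-2^k*odd f k odd k<f) ⟩
    suc k                             ∎
    where open ≡-Reasoning

  δ[2^k*odd]≡k : ∀ k {o} → Odd o → δ (2 ^ k * o) ≡ k
  δ[2^k*odd]≡k k {o} odd = δ-fuel-2^k*odd (2 ^ k * o) k odd
    (<-≤-trans (n<2^n k) (m≤m*n (2 ^ k) o {{odd⇒nonZero odd}}))

  δ[2^k]≡k : ∀ k → δ (2 ^ k) ≡ k
  δ[2^k]≡k k = trans (cong δ (sym (*-identityʳ (2 ^ k)))) (δ[2^k*odd]≡k k {1} (>⇒∤ (s≤s (s≤s z≤n))))

  private
    2^k*odd-decomposition : ∀ n .{{_ : NonZero n}} → Acc _<_ n → ∃₂ λ k o → Odd o × n ≡ 2 ^ k * o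
    2^k*odd-decomposition n (acc rec) with 2 ∣? n
    ... | no  odd = 0 , n , odd , sym (*-identityˡ n)
    ... | yes (divides q refl) with 2^k*odd-decomposition q {{q≢0}} (rec (m<m*n q 2 {{q≢0}} (s≤s (s≤s z≤n))))
      where q≢0 = m*n≢0⇒m≢0 q
    ...   | k , o , odd , refl = suc k , o , odd , trans (*-comm (2 ^ k * o) 2) (sym (*-assoc 2 (2 ^ k) o))

  n≡2^δn*odd : ∀ n .{{_ : NonZero n}} → ∃ λ o → Odd o × n ≡ 2 ^ δ n * o
  n≡2^δn*odd n with 2^k*odd-decomposition n (<-wellFounded n)
  ... | k , o , odd , refl = o , odd , cong (λ e → 2 ^ e * o) (sym (δ[2^k*odd]≡k k odd))

  δ-* : ∀ m n .{{_ : NonZero m}} .{{_ : NonZero n}} → δ (m * n) ≡ δ m + δ n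
  δ-* m n with n≡2^δn*odd m | n≡2^δn*odd n
  ... | o , odd-o , m≡ | p , odd-p , n≡ = begin
    δ (m * n)                        ≡⟨ cong δ (cong₂ _*_ m≡ n≡) ⟩
    δ (2 ^ δ m * o * (2 ^ δ n * p))  ≡⟨ cong δ (interchange (2 ^ δ m) o (2 ^ δ n) p) ⟩
    δ (2 ^ δ m * 2 ^ δ n * (o * p))  ≡⟨ cong (λ e → δ (e * (o * p))) (^-distribˡ-+-* 2 (δ m) (δ n)) ⟨
    δ (2 ^ (δ m + δ n) * (o * p))    ≡⟨ δ[2^k*odd]≡k (δ m + δ n) (odd*odd⇒odd odd-o odd-p) ⟩
    δ m + δ n                        ∎
    where open ≡-Reasoning

  2^δn∣n : ∀ n .{{_ : NonZero n}} → 2 ^ δ n ∣ n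
  2^δn∣n n with n≡2^δn*odd n
  ... | o , _ , n≡ = divides o (trans n≡ (*-comm (2 ^ δ n) o))

  2^j∣n⇒j≤δn : ∀ j n .{{_ : NonZero n}} → 2 ^ j ∣ n → j ≤ δ n
  2^j∣n⇒j≤δn j n 2^j∣n with j ≤? δ n | n≡2^δn*odd n
  ... | yes j≤δn | _              = j≤δn
  ... | no  j≰δn | o , odd , n≡   = contradiction 2∣o odd
    where
    2^δn*2∣2^δn*o : 2 ^ δ n * 2 ∣ 2 ^ δ n * o
    2^δn*2∣2^δn*o = subst₂ _∣_ (*-comm 2 (2 ^ δ n)) n≡ (∣-trans (^-monoʳ-∣ 2 (≰⇒> j≰δn)) 2^j∣n)
    2∣o : 2 ∣ o
    2∣o = *-cancelˡ-∣ (2 ^ δ n) {{m^n≢0 2 (δ n)}} 2^δn*2∣2^δn*o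

  δ-gcd : ∀ m n .{{_ : NonZero m}} .{{_ : NonZero n}} → δ (gcd m n) ≡ δ m ⊓ δ n
  δ-gcd m n = ≤-antisym
    (⊓-glb (2^j∣n⇒j≤δn _ m (∣-trans (2^δn∣n (gcd m n)) (gcd[m,n]∣m m n)))
           (2^j∣n⇒j≤δn _ n (∣-trans (2^δn∣n (gcd m n)) (gcd[m,n]∣n m n))))
    (2^j∣n⇒j≤δn _ (gcd m n) (gcd-greatest (∣-trans (^-monoʳ-∣ 2 (m⊓n≤m (δ m) (δ n))) (2^δn∣n m))
                                          (∣-trans (^-monoʳ-∣ 2 (m⊓n≤n (δ m) (δ n))) (2^δn∣n n))))
    where
    instance
      _ : NonZero (gcd m n)
      _ = ≢-nonZero (gcd[m,n]≢0 m n (inj₁ (≢-nonZero⁻¹ m)))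

  ∣2^n⇒≡2^δ : ∀ {d} n → d ∣ 2 ^ n → d ≡ 2 ^ δ d
  ∣2^n⇒≡2^δ {d} n d∣2^n with n≡2^δn*odd d {{d≢0}}
    where
    d≢0 : NonZero d
    d≢0 = ≢-nonZero λ { refl → ≢-nonZero⁻¹ (2 ^ n) {{m^n≢0 2 n}} (0∣⇒≡0 d∣2^n) }
  ... | o , odd , d≡ with odd∣2^n⇒≡1 n odd (∣-trans (subst (o ∣_) (sym d≡) (n∣m*n (2 ^ δ d))) d∣2^n)
  ...   | refl = trans d≡ (*-identityʳ (2 ^ δ d))

module Fraction where

  open Valuation using (δ-*)
  open import Data.Nat as ℕ using (ℕ; zero; suc; NonZero; _^_; _∸_; _⊓_)
  import Data.Nat.Properties as ℕP
  import Data.Nat.GCD as ℕG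
  open import Data.Integer as ℤ using (+_; -[1+_])
  import Data.Integer.Properties as ℤP
  open import Data.Integer.GCD using (gcd)
  open import Data.Integer.Tactic.RingSolver using (solve-∀)
  open import Data.Rational as ℚ using (mkℚ; ↥_; ↧ₙ_; _/_; _*_; _+_; -_; 1ℚ; 0ℚ; ∣_∣; toℚᵘ)
  import Data.Rational.Properties as ℚP
  import Data.Rational.Unnormalised as ℚᵘ
  import Data.Rational.Unnormalised.Properties as ℚᵘP
  open import Data.Bool using (true; false; T)
  open import Data.Sum using (inj₁; inj₂)
  open import Function using (_∘_)
  open import Relation.Binary.PropositionalEquality
  open import Relation.Nullary using (yes; no; contradiction)

  private
    toℚᵘ-/ : ∀ i n .{{_ : NonZero n}} → toℚᵘ (i / n) ℚᵘ.≃ (i ℚᵘ./ n)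
    toℚᵘ-/ i (suc n) = ℚP.toℚᵘ-fromℚᵘ (ℚᵘ.mkℚᵘ i n)

  cross-multiply : ∀ i j m n .{{_ : NonZero m}} .{{_ : NonZero n}} → i ℤ.* + n ≡ j ℤ.* + m → i / m ≡ j / n
  cross-multiply i j (suc m) (suc n) eq = ℚP.fromℚᵘ-cong {ℚᵘ.mkℚᵘ i m} {ℚᵘ.mkℚᵘ j n} (ℚᵘ.*≡* eq)

  *-/ : ∀ i j m n .{{_ : NonZero m}} .{{_ : NonZero n}} →
        (i / m) * (j / n) ≡ ((i ℤ.* j) / (m ℕ.* n)) {{ℕP.m*n≢0 m n}}
  *-/ i j m@(suc _) n@(suc _) = ℚP.toℚᵘ-injective (ℚᵘP.≃-trans (ℚP.toℚᵘ-homo-* (i / m) (j / n))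
    (ℚᵘP.≃-trans (ℚᵘP.*-cong (toℚᵘ-/ i m) (toℚᵘ-/ j n)) (ℚᵘP.≃-sym (toℚᵘ-/ (i ℤ.* j) (m ℕ.* n)))))

  +-/ : ∀ i j m n .{{_ : NonZero m}} .{{_ : NonZero n}} →
        (i / m) + (j / n) ≡ ((i ℤ.* + n ℤ.+ j ℤ.* + m) / (m ℕ.* n)) {{ℕP.m*n≢0 m n}}
  +-/ i j m@(suc _) n@(suc _) = ℚP.toℚᵘ-injective (ℚᵘP.≃-trans (ℚP.toℚᵘ-homo-+ (i / m) (j / n))
    (ℚᵘP.≃-trans (ℚᵘP.+-cong (toℚᵘ-/ i m) (toℚᵘ-/ j n)) (ℚᵘP.≃-sym (toℚᵘ-/ _ (m ℕ.* n)))))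

  -‿/ : ∀ i n .{{_ : NonZero n}} → - (i / n) ≡ (ℤ.- i) / n
  -‿/ i n@(suc _) = ℚP.toℚᵘ-injective (ℚᵘP.≃-trans (ℚP.toℚᵘ-homo‿- (i / n))
    (ℚᵘP.≃-trans (ℚᵘP.-‿cong (toℚᵘ-/ i n)) (ℚᵘP.≃-sym (toℚᵘ-/ (ℤ.- i) n))))

  ∣/∣ : ∀ i n .{{_ : NonZero n}} → ∣ i / n ∣ ≡ + ℤ.∣ i ∣ / n
  ∣/∣ i n@(suc _) = ℚP.toℚᵘ-injective (ℚᵘP.≃-trans (ℚP.toℚᵘ-homo-∣-∣ (i / n))
    (ℚᵘP.≃-trans (ℚᵘP.∣-∣-cong (toℚᵘ-/ i n)) (ℚᵘP.≃-sym (toℚᵘ-/ (+ ℤ.∣ i ∣) n))))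

  sq-/ : ∀ m n .{{_ : NonZero n}} → sq (+ m / n) ≡ (+ (m ℕ.* m) / (n ℕ.* n)) {{ℕP.m*n≢0 n n}}
  sq-/ m n = trans (*-/ (+ m) (+ m) n n) (ℚP./-cong {{ℕP.m*n≢0 n n}} {{ℕP.m*n≢0 n n}} (sym (ℤP.pos-* m m)) refl)

  1+m/n : ∀ m n .{{_ : NonZero n}} → 1ℚ + + m / n ≡ + (n ℕ.+ m) / n
  1+m/n m n = trans (+-/ (+ 1) (+ m) 1 n)
    (ℚP./-cong {{ℕP.m*n≢0 1 n}} (cong₂ ℤ._+_ (ℤP.*-identityˡ (+ n)) (ℤP.*-identityʳ (+ m))) (ℕP.*-identityˡ n))

  m/n*i/m≡i/n : ∀ i m n .{{_ : NonZero m}} .{{_ : NonZero n}} → (+ m / n) * (i / m) ≡ i / n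
  m/n*i/m≡i/n i m n = trans (*-/ (+ m) i n m) (cross-multiply (+ m ℤ.* i) i (n ℕ.* m) n {{ℕP.m*n≢0 n m}} (begin
    + m ℤ.* i ℤ.* + n       ≡⟨ reorder (+ m) i (+ n) ⟩
    i ℤ.* (+ n ℤ.* + m)     ≡⟨ cong (i ℤ.*_) (ℤP.pos-* n m) ⟨
    i ℤ.* + (n ℕ.* m)       ∎))
    where
    open ≡-Reasoning
    reorder : ∀ a b c → a ℤ.* b ℤ.* c ≡ b ℤ.* (c ℤ.* a)
    reorder = solve-∀

  n/n≡1 : ∀ n .{{_ : NonZero n}} → + n / n ≡ 1ℚ
  n/n≡1 n = cross-multiply (+ n) (+ 1) n 1 (ℤP.*-comm (+ n) (+ 1))

  inv-unique : ∀ p q → p * q ≡ 1ℚ → inv p ≡ q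
  inv-unique p q pq≡1 with p ℚP.≟ 0ℚ
  ... | yes refl = contradiction (trans (sym (ℚP.*-zeroˡ q)) pq≡1) (ℚP.1≢0 ∘ sym)
  ... | no p≢0 = begin
    ℚ.1/ p             ≡⟨ ℚP.*-identityʳ (ℚ.1/ p) ⟨
    ℚ.1/ p * 1ℚ        ≡⟨ cong (ℚ.1/ p *_) pq≡1 ⟨
    ℚ.1/ p * (p * q)   ≡⟨ ℚP.*-assoc (ℚ.1/ p) p q ⟨
    ℚ.1/ p * p * q     ≡⟨ cong (_* q) (ℚP.*-inverseˡ p) ⟩
    1ℚ * q             ≡⟨ ℚP.*-identityˡ q ⟩
    q                  ∎
    where
    open ≡-Reasoning
    instance _ = ℚ.≢-nonZero p≢0

  inv-/ : ∀ m n .{{_ : NonZero m}} .{{_ : NonZero n}} → inv (+ m / n) ≡ + n / m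
  inv-/ m n = inv-unique (+ m / n) (+ n / m) (trans (m/n*i/m≡i/n (+ n) m n) (n/n≡1 n))

  2^[m∸n]*2^n≡2^m : ∀ {m n} → n ℕ.≤ m → 2 ^ (m ∸ n) ℕ.* 2 ^ n ≡ 2 ^ m
  2^[m∸n]*2^n≡2^m {m} {n} n≤m = trans (sym (ℕP.^-distribˡ-+-* 2 (m ∸ n) n)) (cong (2 ^_) (ℕP.m∸n+n≡m n≤m))

  pow2-neg : ∀ n → pow2 (ℤ.- + n) ≡ (+ 1 / 2 ^ n) {{ℕP.m^n≢0 2 n}}
  pow2-neg zero    = refl
  pow2-neg (suc n) = inv-/ (2 ^ suc n) 1 {{ℕP.m^n≢0 2 (suc n)}}

  pow2-diff : ∀ m n → pow2 (+ m ℤ.- + n) ≡ (+ 2 ^ m / 2 ^ n) {{ℕP.m^n≢0 2 n}}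
  pow2-diff m n with ℕP.≤-<-connex n m
  ... | inj₁ n≤m = begin
    pow2 (+ m ℤ.- + n)   ≡⟨ cong pow2 (trans (ℤP.m-n≡m⊖n m n) (ℤP.⊖-≥ n≤m)) ⟩
    + 2 ^ (m ∸ n) / 1    ≡⟨ cross-multiply (+ 2 ^ (m ∸ n)) (+ 2 ^ m) 1 (2 ^ n) cross ⟩
    + 2 ^ m / 2 ^ n      ∎
    where
    open ≡-Reasoning
    instance _ = ℕP.m^n≢0 2 n
    cross : + 2 ^ (m ∸ n) ℤ.* + 2 ^ n ≡ + 2 ^ m ℤ.* + 1
    cross = trans (sym (ℤP.pos-* (2 ^ (m ∸ n)) (2 ^ n)))
                  (trans (cong +_ (2^[m∸n]*2^n≡2^m n≤m)) (sym (ℤP.*-identityʳ (+ 2 ^ m))))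
  ... | inj₂ m<n = begin
    pow2 (+ m ℤ.- + n)        ≡⟨ cong pow2 (trans (ℤP.m-n≡m⊖n m n) (ℤP.⊖-< m<n)) ⟩
    pow2 (ℤ.- + (n ∸ m))      ≡⟨ pow2-neg (n ∸ m) ⟩
    + 1 / 2 ^ (n ∸ m)         ≡⟨ cross-multiply (+ 1) (+ 2 ^ m) (2 ^ (n ∸ m)) (2 ^ n) cross ⟩
    + 2 ^ m / 2 ^ n           ∎
    where
    open ≡-Reasoning
    instance
      _ = ℕP.m^n≢0 2 n
      _ = ℕP.m^n≢0 2 (n ∸ m)
    cross : + 1 ℤ.* + 2 ^ n ≡ + 2 ^ m ℤ.* + 2 ^ (n ∸ m)
    cross = trans (ℤP.*-identityˡ (+ 2 ^ n)) (trans (cong +_ (sym (2^[m∸n]*2^n≡2^m (ℕP.<⇒≤ m<n))))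
              (trans (ℤP.pos-* (2 ^ (n ∸ m)) (2 ^ m)) (ℤP.*-comm (+ 2 ^ (n ∸ m)) (+ 2 ^ m))))

  private
    abs₂-unfold : ∀ p → ↥ p ≢ + 0 → abs₂ p ≡ pow2 (+ δ (↧ₙ p) ℤ.- + δ ℤ.∣ ↥ p ∣)
    abs₂-unfold (mkℚ (+ zero)  _ _) ↥p≢0 = contradiction refl ↥p≢0
    abs₂-unfold (mkℚ (+ suc _) _ _) _    = refl
    abs₂-unfold (mkℚ -[1+ _ ]  _ _) _    = refl

  -- δ is additive, so the common factor removed by normalisation cancels in the exponent.
  abs₂-/ : ∀ i n .{{_ : NonZero n}} → i ≢ + 0 →
           abs₂ (i / n) ≡ (+ 2 ^ δ n / 2 ^ δ ℤ.∣ i ∣) {{ℕP.m^n≢0 2 (δ ℤ.∣ i ∣)}}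
  abs₂-/ i n i≢0 = trans (abs₂-unfold (i / n) ↥≢0) (trans (cong pow2 exponent) (pow2-diff (δ n) (δ ℤ.∣ i ∣)))
    where
    open ≡-Reasoning
    k = ℕG.gcd ℤ.∣ i ∣ n
    ↥≢0 : ↥ (i / n) ≢ + 0
    ↥≢0 ↥≡0 = i≢0 (trans (sym (ℚP.↥-/ i n)) (cong (ℤ._* gcd i (+ n)) ↥≡0))
    instance
      _ : NonZero k
      _ = ℕ.≢-nonZero (ℕG.gcd[m,n]≢0 ℤ.∣ i ∣ n (inj₂ (ℕ.≢-nonZero⁻¹ n)))
      _ : NonZero ℤ.∣ ↥ (i / n) ∣
      _ = ℕ.≢-nonZero (↥≢0 ∘ ℤP.∣i∣≡0⇒i≡0)
    numerator : ℤ.∣ ↥ (i / n) ∣ ℕ.* k ≡ ℤ.∣ i ∣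
    numerator = trans (sym (ℤP.abs-* (↥ (i / n)) (+ k))) (cong ℤ.∣_∣ (ℚP.↥-/ i n))
    denominator : ↧ₙ (i / n) ℕ.* k ≡ n
    denominator = ℤP.+-injective (trans (ℤP.pos-* (↧ₙ (i / n)) k) (ℚP.↧-/ i n))
    cancel : ∀ a b c → (a ℤ.+ c) ℤ.- (b ℤ.+ c) ≡ a ℤ.- b
    cancel = solve-∀
    exponent : + δ (↧ₙ (i / n)) ℤ.- + δ ℤ.∣ ↥ (i / n) ∣ ≡ + δ n ℤ.- + δ ℤ.∣ i ∣
    exponent = begin
      + δ (↧ₙ (i / n)) ℤ.- + δ ℤ.∣ ↥ (i / n) ∣
        ≡⟨ cancel (+ δ (↧ₙ (i / n))) (+ δ ℤ.∣ ↥ (i / n) ∣) (+ δ k) ⟨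
      (+ δ (↧ₙ (i / n)) ℤ.+ + δ k) ℤ.- (+ δ ℤ.∣ ↥ (i / n) ∣ ℤ.+ + δ k)
        ≡⟨ cong₂ (λ a b → + a ℤ.- + b) (δ-* (↧ₙ (i / n)) k) (δ-* ℤ.∣ ↥ (i / n) ∣ k) ⟨
      + δ (↧ₙ (i / n) ℕ.* k) ℤ.- + δ (ℤ.∣ ↥ (i / n) ∣ ℕ.* k)
        ≡⟨ cong₂ (λ a b → + δ a ℤ.- + δ b) denominator numerator ⟩
      + δ n ℤ.- + δ ℤ.∣ i ∣ ∎

  m/n≤1 : ∀ m n .{{_ : NonZero n}} → m ℕ.≤ n → + m / n ℚ.≤ 1ℚ
  m/n≤1 m n@(suc _) m≤n = ℚP.toℚᵘ-cancel-≤ (ℚᵘP.≤-respˡ-≃ (ℚᵘP.≃-sym (toℚᵘ-/ (+ m) n))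
    (ℚᵘ.*≤* (subst₂ ℤ._≤_ (sym (ℤP.*-identityʳ (+ m))) (sym (ℤP.*-identityˡ (+ n))) (ℤ.+≤+ m≤n))))

  1<m/n : ∀ m n .{{_ : NonZero n}} → n ℕ.< m → 1ℚ ℚ.< + m / n
  1<m/n m n@(suc _) n<m = ℚP.toℚᵘ-cancel-< (ℚᵘP.<-respʳ-≃ (ℚᵘP.≃-sym (toℚᵘ-/ (+ m) n))
    (ℚᵘ.*<* (subst₂ ℤ._<_ (sym (ℤP.*-identityˡ (+ n))) (sym (ℤP.*-identityʳ (+ m))) (ℤ.+<+ n<m))))

  module _ (u v : ℕ) where
    private instance
      _ = ℕP.m^n≢0 2 u
      _ = ℕP.m^n≢0 2 v
      _ = ℕP.m*n≢0 (2 ^ u) (2 ^ u)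
      _ = ℕP.m*n≢0 (2 ^ v) (2 ^ v)

    G₂-2^ : ∀ y → abs₂ y ≡ + 2 ^ u / 2 ^ v → G₂ y ≡ + (2 ^ (v ⊓ u) ℕ.* 2 ^ (v ⊓ u)) / (2 ^ u ℕ.* 2 ^ u)
    G₂-2^ y ∣y∣₂≡ with abs₂ y | ∣y∣₂≡ | ℕP.≤-<-connex u v
    ... | _ | refl | inj₁ u≤v with + 2 ^ u / 2 ^ v ℚ.≤ᵇ 1ℚ | ℚP.≤⇒≤ᵇ (m/n≤1 (2 ^ u) (2 ^ v) (ℕP.^-monoʳ-≤ 2 u≤v))
    ...   | true | _ = begin
      1ℚ
        ≡⟨ n/n≡1 (2 ^ u ℕ.* 2 ^ u) ⟨
      + (2 ^ u ℕ.* 2 ^ u) / (2 ^ u ℕ.* 2 ^ u)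
        ≡⟨ ℚP./-cong (cong (λ w → + (2 ^ w ℕ.* 2 ^ w)) (sym (ℕP.m≥n⇒m⊓n≡n u≤v))) refl ⟩
      + (2 ^ (v ⊓ u) ℕ.* 2 ^ (v ⊓ u)) / (2 ^ u ℕ.* 2 ^ u) ∎
      where open ≡-Reasoning
    G₂-2^ y ∣y∣₂≡ | _ | refl | inj₂ v<u with + 2 ^ u / 2 ^ v ℚ.≤ᵇ 1ℚ in ≤ᵇ≡
    ...   | true  = contradiction
      (ℚP.<-≤-trans (1<m/n (2 ^ u) (2 ^ v) (ℕP.^-monoʳ-< 2 (ℕ.s≤s (ℕ.s≤s ℕ.z≤n)) v<u))
                    (ℚP.≤ᵇ⇒≤ (subst T (sym ≤ᵇ≡) _)))
      (ℚP.<-irrefl refl)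
    ...   | false = begin
      inv (sq (+ 2 ^ u / 2 ^ v))
        ≡⟨ cong inv (sq-/ (2 ^ u) (2 ^ v)) ⟩
      inv (+ (2 ^ u ℕ.* 2 ^ u) / (2 ^ v ℕ.* 2 ^ v))
        ≡⟨ inv-/ (2 ^ u ℕ.* 2 ^ u) (2 ^ v ℕ.* 2 ^ v) ⟩
      + (2 ^ v ℕ.* 2 ^ v) / (2 ^ u ℕ.* 2 ^ u)
        ≡⟨ ℚP./-cong (cong (λ w → + (2 ^ w ℕ.* 2 ^ w)) (sym (ℕP.m≤n⇒m⊓n≡m (ℕP.<⇒≤ v<u)))) refl ⟩
      + (2 ^ (v ⊓ u) ℕ.* 2 ^ (v ⊓ u)) / (2 ^ u ℕ.* 2 ^ u) ∎
      where open ≡-Reasoning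

module Continuant where

  open Fraction
  open import Data.Nat as ℕ using (ℕ; NonZero; _^_)
  import Data.Nat.Properties as ℕP
  open import Data.Integer as ℤ using (ℤ; +_)
  import Data.Integer.Properties as ℤP
  import Data.Integer.GCD as ℤG
  import Data.Integer.Divisibility as ℤDᵤ
  import Data.Integer.Divisibility.Signed as ℤD
  open import Data.Integer.Tactic.RingSolver using (solve-∀)
  open import Data.Rational as ℚ using (_/_; _*_; _+_; -_; 0ℚ; 1ℚ)
  import Data.Rational.Properties as ℚP
  open import Data.Vec using (Vec; []; _∷_; sum)
  open import Relation.Binary.PropositionalEquality

  det-⊗ : ∀ X Y → det (X ⊗ Y) ≡ det X ℤ.* det Y
  det-⊗ (mat a b c d) (mat e f g h) = expand a b c d e f g h
    where
    expand : ∀ a b c d e f g h →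
      (a ℤ.* e ℤ.+ b ℤ.* g) ℤ.* (c ℤ.* f ℤ.+ d ℤ.* h) ℤ.- (a ℤ.* f ℤ.+ b ℤ.* h) ℤ.* (c ℤ.* e ℤ.+ d ℤ.* g)
      ≡ (a ℤ.* d ℤ.- b ℤ.* c) ℤ.* (e ℤ.* h ℤ.- f ℤ.* g)
    expand = solve-∀

  det-M : ∀ a → det (M a) ≡ ℤ.- + 2 ^ a
  det-M a = trans (ℤP.+-identityˡ _) (cong ℤ.-_ (ℤP.*-identityˡ (+ 2 ^ a)))

  ∣det-Mvec∣ : ∀ {k} (as : Vec ℕ k) → ℤ.∣ det (Mvec as) ∣ ≡ 2 ^ sum as
  ∣det-Mvec∣ []       = refl
  ∣det-Mvec∣ (a ∷ as) = begin
    ℤ.∣ det (M a ⊗ Mvec as) ∣                  ≡⟨ cong ℤ.∣_∣ (det-⊗ (M a) (Mvec as)) ⟩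
    ℤ.∣ det (M a) ℤ.* det (Mvec as) ∣          ≡⟨ ℤP.abs-* (det (M a)) (det (Mvec as)) ⟩
    ℤ.∣ det (M a) ∣ ℕ.* ℤ.∣ det (Mvec as) ∣    ≡⟨ cong₂ ℕ._*_ ∣det-M∣ (∣det-Mvec∣ as) ⟩
    2 ^ a ℕ.* 2 ^ sum as                       ≡⟨ ℕP.^-distribˡ-+-* 2 a (sum as) ⟨
    2 ^ (a ℕ.+ sum as)                         ∎
    where
    open ≡-Reasoning
    ∣det-M∣ : ℤ.∣ det (M a) ∣ ≡ 2 ^ a
    ∣det-M∣ = trans (cong ℤ.∣_∣ (det-M a)) (ℤP.∣-i∣≡∣i∣ (+ 2 ^ a))

  gcd∣det : ∀ X → ℤG.gcd (m12 X) (m22 X) ℤDᵤ.∣ det X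
  gcd∣det (mat a b c d) = ℤD.∣⇒∣ᵤ (ℤD.∣m∣n⇒∣m-n (ℤD.∣n⇒∣m*n a gcd∣d) (ℤD.∣m⇒∣m*n c gcd∣b))
    where
    gcd∣b : ℤG.gcd b d ℤD.∣ b
    gcd∣b = ℤD.∣ᵤ⇒∣ (ℤG.gcd[i,j]∣i b d)
    gcd∣d : ℤG.gcd b d ℤD.∣ d
    gcd∣d = ℤD.∣ᵤ⇒∣ (ℤG.gcd[i,j]∣j b d)

  Pℕ Qℕ : ∀ {k} → Vec ℕ k → ℕ
  Pℕ []       = 0
  Pℕ (a ∷ as) = Qℕ as
  Qℕ []       = 1
  Qℕ (a ∷ as) = 2 ^ a ℕ.* (Pℕ as ℕ.+ Qℕ as)

  P≡+Pℕ : ∀ {k} (as : Vec ℕ k) → P as ≡ + Pℕ as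
  Q≡+Qℕ : ∀ {k} (as : Vec ℕ k) → Q as ≡ + Qℕ as
  P≡+Pℕ []       = refl
  P≡+Pℕ (a ∷ as) = trans (ℤP.+-identityˡ _) (trans (ℤP.*-identityˡ (Q as)) (Q≡+Qℕ as))
  Q≡+Qℕ []       = refl
  Q≡+Qℕ (a ∷ as) = begin
    + 2 ^ a ℤ.* P as ℤ.+ + 2 ^ a ℤ.* Q as   ≡⟨ ℤP.*-distribˡ-+ (+ 2 ^ a) (P as) (Q as) ⟨
    + 2 ^ a ℤ.* (P as ℤ.+ Q as)              ≡⟨ cong₂ (λ i j → + 2 ^ a ℤ.* (i ℤ.+ j)) (P≡+Pℕ as) (Q≡+Qℕ as) ⟩
    + 2 ^ a ℤ.* (+ Pℕ as ℤ.+ + Qℕ as)        ≡⟨ ℤP.pos-* (2 ^ a) (Pℕ as ℕ.+ Qℕ as) ⟨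
    + Qℕ (a ∷ as)                            ∎
    where open ≡-Reasoning

  continuant-nonZero : ∀ a p q .{{_ : NonZero q}} → NonZero (2 ^ a ℕ.* (p ℕ.+ q))
  continuant-nonZero a p q = ℕP.m*n≢0 (2 ^ a) (p ℕ.+ q) {{ℕP.m^n≢0 2 a}}
    {{ℕ.>-nonZero (ℕP.<-≤-trans (ℕ.>-nonZero⁻¹ q) (ℕP.m≤n+m q p))}}

  Qℕ≢0 : ∀ {k} (as : Vec ℕ k) → NonZero (Qℕ as)
  Qℕ≢0 []       = _
  Qℕ≢0 (a ∷ as) = continuant-nonZero a (Pℕ as) (Qℕ as) {{Qℕ≢0 as}}

  -- Value and derivative at 0 of a Möbius map x ↦ (A x + p) / (C x + q) of determinant Δ.
  jet₀ : ∀ p q .{{_ : NonZero q}} → ℤ → Dual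
  jet₀ p q Δ = dual (+ p / q) ((Δ / (q ℕ.* q)) {{ℕP.m*n≢0 q q}})

  der-hₐ : ∀ a x → der (hₐ a x) ≡ pow2 (ℤ.- + a) * (- (der x * inv (sq (1ℚ + val x))))
  der-hₐ a (dual v v′) =
    trans (cong₂ _+_ (cong (λ z → pow2 (ℤ.- + a) * (- (z * inv (sq (1ℚ + v))))) (ℚP.+-identityˡ v′))
                     (ℚP.*-zeroˡ (inv (1ℚ + v))))
          (ℚP.+-identityʳ _)

  module _ (a p q : ℕ) .{{_ : NonZero q}} where
    private
      q′ = 2 ^ a ℕ.* (p ℕ.+ q)
      s = q ℕ.+ p
      instance
        _ = ℕP.m^n≢0 2 a
        _ = ℕP.m*n≢0 q q
        _ = continuant-nonZero a p q
        _ = ℕP.m*n≢0 q′ q′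
        _ = ℕ.>-nonZero (ℕP.<-≤-trans (ℕ.>-nonZero⁻¹ q) (ℕP.m≤m+n q p))
        _ = ℕP.m*n≢0 s s
        _ = ℕP.m*n≢0 (2 ^ a) s
        _ = ℕP.m*n≢0 (2 ^ a) (s ℕ.* s)

      hₐ-jet₀-val : pow2 (ℤ.- + a) * inv (1ℚ + + p / q) ≡ + q / q′
      hₐ-jet₀-val = begin
        pow2 (ℤ.- + a) * inv (1ℚ + + p / q)    ≡⟨ cong₂ (λ c w → c * inv w) (pow2-neg a) (1+m/n p q) ⟩
        + 1 / 2 ^ a * inv (+ s / q)            ≡⟨ cong (+ 1 / 2 ^ a *_) (inv-/ s q) ⟩
        + 1 / 2 ^ a * (+ q / s)                ≡⟨ *-/ (+ 1) (+ q) (2 ^ a) s ⟩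
        (+ 1 ℤ.* + q) / (2 ^ a ℕ.* s)          ≡⟨ ℚP./-cong (ℤP.*-identityˡ (+ q)) (cong (2 ^ a ℕ.*_) (ℕP.+-comm q p)) ⟩
        + q / q′                               ∎
        where open ≡-Reasoning

      hₐ-jet₀-der-cross : ∀ Δ → (+ 1 ℤ.* ℤ.- Δ) ℤ.* + (q′ ℕ.* q′)
                                ≡ (ℤ.- + 2 ^ a ℤ.* Δ) ℤ.* + (2 ^ a ℕ.* (s ℕ.* s))
      hₐ-jet₀-der-cross Δ = begin
        (+ 1 ℤ.* ℤ.- Δ) ℤ.* + (q′ ℕ.* q′)
          ≡⟨ cong ((+ 1 ℤ.* ℤ.- Δ) ℤ.*_) (trans (ℤP.pos-* q′ q′) (cong₂ ℤ._*_ cast-q′ cast-q′)) ⟩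
        (+ 1 ℤ.* ℤ.- Δ) ℤ.* ((t ℤ.* (+ p ℤ.+ + q)) ℤ.* (t ℤ.* (+ p ℤ.+ + q)))
          ≡⟨ expand t (+ p) (+ q) Δ ⟩
        (ℤ.- t ℤ.* Δ) ℤ.* (t ℤ.* ((+ q ℤ.+ + p) ℤ.* (+ q ℤ.+ + p)))
          ≡⟨ cong ((ℤ.- t ℤ.* Δ) ℤ.*_) (trans (ℤP.pos-* (2 ^ a) (s ℕ.* s)) (cong (t ℤ.*_) (ℤP.pos-* s s))) ⟨
        (ℤ.- t ℤ.* Δ) ℤ.* + (2 ^ a ℕ.* (s ℕ.* s)) ∎
        where
        open ≡-Reasoning
        t = + 2 ^ a
        cast-q′ : + q′ ≡ t ℤ.* (+ p ℤ.+ + q)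
        cast-q′ = ℤP.pos-* (2 ^ a) (p ℕ.+ q)
        expand : ∀ t P Q Δ → (+ 1 ℤ.* ℤ.- Δ) ℤ.* ((t ℤ.* (P ℤ.+ Q)) ℤ.* (t ℤ.* (P ℤ.+ Q)))
                             ≡ (ℤ.- t ℤ.* Δ) ℤ.* (t ℤ.* ((Q ℤ.+ P) ℤ.* (Q ℤ.+ P)))
        expand = solve-∀

      hₐ-jet₀-der : ∀ Δ → pow2 (ℤ.- + a) * (- (Δ / (q ℕ.* q) * inv (sq (1ℚ + + p / q))))
                     ≡ (ℤ.- + 2 ^ a ℤ.* Δ) / (q′ ℕ.* q′)
      hₐ-jet₀-der Δ = begin
        pow2 (ℤ.- + a) * (- (Δ / (q ℕ.* q) * inv (sq (1ℚ + + p / q))))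
          ≡⟨ cong₂ (λ c w → c * (- (Δ / (q ℕ.* q) * inv (sq w)))) (pow2-neg a) (1+m/n p q) ⟩
        + 1 / 2 ^ a * (- (Δ / (q ℕ.* q) * inv (sq (+ s / q))))
          ≡⟨ cong (λ z → + 1 / 2 ^ a * (- (Δ / (q ℕ.* q) * inv z))) (sq-/ s q) ⟩
        + 1 / 2 ^ a * (- (Δ / (q ℕ.* q) * inv (+ (s ℕ.* s) / (q ℕ.* q))))
          ≡⟨ cong (λ z → + 1 / 2 ^ a * (- (Δ / (q ℕ.* q) * z))) (inv-/ (s ℕ.* s) (q ℕ.* q)) ⟩
        + 1 / 2 ^ a * (- (Δ / (q ℕ.* q) * (+ (q ℕ.* q) / (s ℕ.* s))))
          ≡⟨ cong (λ z → + 1 / 2 ^ a * (- z)) (trans (ℚP.*-comm (Δ / (q ℕ.* q)) (+ (q ℕ.* q) / (s ℕ.* s)))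
                                                      (m/n*i/m≡i/n Δ (q ℕ.* q) (s ℕ.* s))) ⟩
        + 1 / 2 ^ a * (- (Δ / (s ℕ.* s)))
          ≡⟨ cong (+ 1 / 2 ^ a *_) (-‿/ Δ (s ℕ.* s)) ⟩
        + 1 / 2 ^ a * ((ℤ.- Δ) / (s ℕ.* s))
          ≡⟨ *-/ (+ 1) (ℤ.- Δ) (2 ^ a) (s ℕ.* s) ⟩
        (+ 1 ℤ.* ℤ.- Δ) / (2 ^ a ℕ.* (s ℕ.* s))
          ≡⟨ cross-multiply (+ 1 ℤ.* ℤ.- Δ) (ℤ.- + 2 ^ a ℤ.* Δ) (2 ^ a ℕ.* (s ℕ.* s)) (q′ ℕ.* q′)
                            (hₐ-jet₀-der-cross Δ) ⟩
        (ℤ.- + 2 ^ a ℤ.* Δ) / (q′ ℕ.* q′) ∎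
        where open ≡-Reasoning

    hₐ-jet₀ : ∀ Δ → hₐ a (jet₀ p q Δ) ≡ jet₀ q q′ (ℤ.- + 2 ^ a ℤ.* Δ)
    hₐ-jet₀ Δ = cong₂ dual hₐ-jet₀-val (trans (der-hₐ a (jet₀ p q Δ)) (hₐ-jet₀-der Δ))

  hvec-jet₀ : ∀ {k} (as : Vec ℕ k) → hvec as (dual 0ℚ 1ℚ) ≡ jet₀ (Pℕ as) (Qℕ as) {{Qℕ≢0 as}} (det (Mvec as))
  hvec-jet₀ []       = refl
  hvec-jet₀ (a ∷ as) = begin
    hₐ a (hvec as (dual 0ℚ 1ℚ))                 ≡⟨ cong (hₐ a) (hvec-jet₀ as) ⟩
    hₐ a (jet₀ p q (det (Mvec as)))             ≡⟨ hₐ-jet₀ a p q (det (Mvec as)) ⟩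
    jet₀ q q′ (ℤ.- + 2 ^ a ℤ.* det (Mvec as))   ≡⟨ cong (jet₀ q q′) det-step ⟨
    jet₀ q q′ (det (M a ⊗ Mvec as))             ∎
    where
    open ≡-Reasoning
    p = Pℕ as
    q = Qℕ as
    q′ = Qℕ (a ∷ as)
    instance
      _ = Qℕ≢0 as
      _ = Qℕ≢0 (a ∷ as)
    det-step : det (M a ⊗ Mvec as) ≡ ℤ.- + 2 ^ a ℤ.* det (Mvec as)
    det-step = trans (det-⊗ (M a) (Mvec as)) (cong (ℤ._* det (Mvec as)) (det-M a))

open import Data.Nat using (ℕ; _≤_)
open import Data.Vec using (Vec)
open import Data.Rational using (ℚ; _*_; ∣_∣)
open import Data.Product using (_×_)
open import Relation.Binary.PropositionalEquality using (_≡_)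

open Valuation using (δ-*; δ[2^k]≡k; δ-gcd; ∣2^n⇒≡2^δ)
open Fraction
open Continuant
open import Data.Nat as ℕ using (suc; NonZero; _^_; _⊓_)
import Data.Nat.Properties as ℕP
import Data.Nat.Divisibility as ℕD
import Data.Nat.GCD as ℕG
open import Data.Integer as ℤ using (+_)
import Data.Integer.Properties as ℤP
import Data.Integer.GCD as ℤG
open import Data.Rational using (_/_)
import Data.Rational.Properties as ℚP
open import Data.Vec using (_∷_; sum)
open import Data.Product using (_,_)
open import Function using (_∘_)
open import Relation.Binary.PropositionalEquality using (sym; trans; cong; cong₂; subst; subst₂; _≢_; module ≡-Reasoning)

-- The four claims once Q = q, d(h) = E, 2^δ(Q) = x and gcd(P,Q) = y are substituted.
module _ (E : ℕ) .{{_ : NonZero E}} where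

  inv-sq-Q-identity : ∀ q .{{_ : NonZero q}} → inv (sq (+ q / 1)) ≡ (+ E / (q ℕ.* q)) {{ℕP.m*n≢0 q q}} * inv (+ E / 1)
  inv-sq-Q-identity q = begin
    inv (sq (+ q / 1))                   ≡⟨ cong inv (sq-/ q 1) ⟩
    inv (+ (q ℕ.* q) / 1)                ≡⟨ inv-/ (q ℕ.* q) 1 ⟩
    + 1 / (q ℕ.* q)                      ≡⟨ m/n*i/m≡i/n (+ 1) E (q ℕ.* q) ⟨
    + E / (q ℕ.* q) * (+ 1 / E)          ≡⟨ cong (+ E / (q ℕ.* q) *_) (inv-/ E 1) ⟨
    + E / (q ℕ.* q) * inv (+ E / 1)      ∎
    where
    open ≡-Reasoning
    instance _ = ℕP.m*n≢0 q q

  module _ (x : ℕ) .{{_ : NonZero x}} where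
    private instance
      _ = ℕP.m*n≢0 x x

    inv-sq-∣Q∣₂-identity : inv (sq (+ 1 / x)) ≡ + E / 1 * (+ (x ℕ.* x) / E)
    inv-sq-∣Q∣₂-identity = begin
      inv (sq (+ 1 / x))                   ≡⟨ cong inv (sq-/ 1 x) ⟩
      inv (+ 1 / (x ℕ.* x))                ≡⟨ inv-/ 1 (x ℕ.* x) ⟩
      + (x ℕ.* x) / 1                      ≡⟨ m/n*i/m≡i/n (+ (x ℕ.* x)) E 1 ⟨
      + E / 1 * (+ (x ℕ.* x) / E)          ∎
      where open ≡-Reasoning

    inv-sq-R-identity : ∀ q y .{{_ : NonZero q}} .{{_ : NonZero y}} → inv (sq (+ q / 1 * inv (+ y / 1)))
                        ≡ (+ E / (q ℕ.* q)) {{ℕP.m*n≢0 q q}} * (+ (x ℕ.* x) / E) * (+ (y ℕ.* y) / (x ℕ.* x))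
    inv-sq-R-identity q y = begin
      inv (sq (+ q / 1 * inv (+ y / 1)))   ≡⟨ cong (λ z → inv (sq (+ q / 1 * z))) (inv-/ y 1) ⟩
      inv (sq (+ q / 1 * (+ 1 / y)))       ≡⟨ cong (inv ∘ sq) (trans (*-/ (+ q) (+ 1) 1 y)
                                                (ℚP./-cong {{ℕP.m*n≢0 1 y}} (ℤP.*-identityʳ (+ q)) (ℕP.*-identityˡ y))) ⟩
      inv (sq (+ q / y))                   ≡⟨ cong inv (sq-/ q y) ⟩
      inv (+ (q ℕ.* q) / (y ℕ.* y))        ≡⟨ inv-/ (q ℕ.* q) (y ℕ.* y) ⟩
      + (y ℕ.* y) / (q ℕ.* q)              ≡⟨ m/n*i/m≡i/n (+ (y ℕ.* y)) (x ℕ.* x) (q ℕ.* q) ⟨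
      + (x ℕ.* x) / (q ℕ.* q) * (+ (y ℕ.* y) / (x ℕ.* x))
                                           ≡⟨ cong (_* (+ (y ℕ.* y) / (x ℕ.* x))) (m/n*i/m≡i/n (+ (x ℕ.* x)) E (q ℕ.* q)) ⟨
      + E / (q ℕ.* q) * (+ (x ℕ.* x) / E) * (+ (y ℕ.* y) / (x ℕ.* x)) ∎
      where
      open ≡-Reasoning
      instance
        _ = ℕP.m*n≢0 q q
        _ = ℕP.m*n≢0 y y

    sq-g-identity : ∀ y → sq (+ y / 1) ≡ + E / 1 * (+ (x ℕ.* x) / E) * (+ (y ℕ.* y) / (x ℕ.* x))
    sq-g-identity y = begin
      sq (+ y / 1)                         ≡⟨ sq-/ y 1 ⟩
      + (y ℕ.* y) / 1                      ≡⟨ m/n*i/m≡i/n (+ (y ℕ.* y)) (x ℕ.* x) 1 ⟨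
      + (x ℕ.* x) / 1 * (+ (y ℕ.* y) / (x ℕ.* x))
                                           ≡⟨ cong (_* (+ (y ℕ.* y) / (x ℕ.* x))) (m/n*i/m≡i/n (+ (x ℕ.* x)) E 1) ⟨
      + E / 1 * (+ (x ℕ.* x) / E) * (+ (y ℕ.* y) / (x ℕ.* x)) ∎
      where open ≡-Reasoning

module _ {k} (a : Vec ℕ k) .{{_ : NonZero (Pℕ a)}} where
  private
    p = Pℕ a
    q = Qℕ a
    S = sum a
    Δ = det (Mvec a)
    u = δ q
    v = δ p
    instance
      _ = Qℕ≢0 a
      _ = ℕP.m*n≢0 q q
      _ = ℕP.m^n≢0 2 S
      _ = ℕP.m^n≢0 2 u
      _ = ℕP.m^n≢0 2 (v ⊓ u)
      _ = ℕP.m*n≢0 (2 ^ u) (2 ^ u)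

    d≡ : d a ≡ + 2 ^ S / 1
    d≡ = cong (λ n → + n / 1) (∣det-Mvec∣ a)

    h0≡ : h0 a ≡ + p / q
    h0≡ = cong val (hvec-jet₀ a)

    h'0≡ : h'0 a ≡ Δ / (q ℕ.* q)
    h'0≡ = cong der (hvec-jet₀ a)

    Δ≢0 : Δ ≢ + 0
    Δ≢0 Δ≡0 = ℕ.≢-nonZero⁻¹ (2 ^ S) (trans (sym (∣det-Mvec∣ a)) (cong ℤ.∣_∣ Δ≡0))

    ∣h'0∣≡ : ∣ h'0 a ∣ ≡ + 2 ^ S / (q ℕ.* q)
    ∣h'0∣≡ = trans (cong ∣_∣ h'0≡) (trans (∣/∣ Δ (q ℕ.* q)) (cong (λ n → + n / (q ℕ.* q)) (∣det-Mvec∣ a)))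

    ∣h'0∣₂≡ : abs₂ (h'0 a) ≡ + (2 ^ u ℕ.* 2 ^ u) / 2 ^ S
    ∣h'0∣₂≡ = trans (cong abs₂ h'0≡) (trans (abs₂-/ Δ (q ℕ.* q) Δ≢0)
      (ℚP./-cong {{ℕP.m^n≢0 2 (δ ℤ.∣ Δ ∣)}} (cong +_ (trans (cong (2 ^_) (δ-* q q)) (ℕP.^-distribˡ-+-* 2 u u)))
                 (cong (2 ^_) (trans (cong δ (∣det-Mvec∣ a)) (δ[2^k]≡k S)))))

    ∣Q∣₂≡ : abs₂ (ℤ→ℚ (Q a)) ≡ + 1 / 2 ^ u
    ∣Q∣₂≡ = trans (cong (abs₂ ∘ ℤ→ℚ) (Q≡+Qℕ a)) (abs₂-/ (+ q) 1 (ℕ.≢-nonZero⁻¹ q ∘ ℤP.+-injective))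

    G₂≡ : G₂ (h0 a) ≡ + (2 ^ (v ⊓ u) ℕ.* 2 ^ (v ⊓ u)) / (2 ^ u ℕ.* 2 ^ u)
    G₂≡ = G₂-2^ u v (h0 a) (trans (cong abs₂ h0≡) (abs₂-/ (+ p) q (ℕ.≢-nonZero⁻¹ p ∘ ℤP.+-injective)))

    g≡ : g (P a) (Q a) ≡ + 2 ^ (v ⊓ u)
    g≡ = trans (cong₂ g (P≡+Pℕ a) (Q≡+Qℕ a)) (cong +_ (trans (∣2^n⇒≡2^δ S gcd∣2^S) (cong (2 ^_) (δ-gcd p q))))
      where
      gcd∣2^S : ℕG.gcd p q ℕD.∣ 2 ^ S
      gcd∣2^S = subst₂ (λ i j → ℤ.∣ ℤG.gcd i j ∣ ℕD.∣ 2 ^ S) (P≡+Pℕ a) (Q≡+Qℕ a)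
                  (subst (ℤ.∣ ℤG.gcd (P a) (Q a) ∣ ℕD.∣_) (∣det-Mvec∣ a) (gcd∣det (Mvec a)))

  inv-sq-Q : inv (sq (ℤ→ℚ (Q a))) ≡ ∣ h'0 a ∣ * inv (d a)
  inv-sq-Q = begin
    inv (sq (ℤ→ℚ (Q a)))                       ≡⟨ cong (inv ∘ sq ∘ ℤ→ℚ) (Q≡+Qℕ a) ⟩
    inv (sq (+ q / 1))                         ≡⟨ inv-sq-Q-identity (2 ^ S) q ⟩
    + 2 ^ S / (q ℕ.* q) * inv (+ 2 ^ S / 1)    ≡⟨ cong₂ (λ r s → r * inv s) ∣h'0∣≡ d≡ ⟨
    ∣ h'0 a ∣ * inv (d a)                      ∎
    where open ≡-Reasoning

  inv-sq-∣Q∣₂ : inv (sq (abs₂ (ℤ→ℚ (Q a)))) ≡ d a * abs₂ (h'0 a)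
  inv-sq-∣Q∣₂ = begin
    inv (sq (abs₂ (ℤ→ℚ (Q a))))                   ≡⟨ cong (inv ∘ sq) ∣Q∣₂≡ ⟩
    inv (sq (+ 1 / 2 ^ u))                        ≡⟨ inv-sq-∣Q∣₂-identity (2 ^ S) (2 ^ u) ⟩
    + 2 ^ S / 1 * (+ (2 ^ u ℕ.* 2 ^ u) / 2 ^ S)   ≡⟨ cong₂ _*_ d≡ ∣h'0∣₂≡ ⟨
    d a * abs₂ (h'0 a)                            ∎
    where open ≡-Reasoning

  inv-sq-R : inv (sq (R (P a) (Q a))) ≡ ∣ h'0 a ∣ * abs₂ (h'0 a) * G₂ (h0 a)
  inv-sq-R = begin
    inv (sq (ℤ→ℚ (Q a) * inv (ℤ→ℚ (g (P a) (Q a)))))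
      ≡⟨ cong₂ (λ i j → inv (sq (ℤ→ℚ i * inv (ℤ→ℚ j)))) (Q≡+Qℕ a) g≡ ⟩
    inv (sq (+ q / 1 * inv (+ 2 ^ (v ⊓ u) / 1)))
      ≡⟨ inv-sq-R-identity (2 ^ S) (2 ^ u) q (2 ^ (v ⊓ u)) ⟩
    + 2 ^ S / (q ℕ.* q) * (+ (2 ^ u ℕ.* 2 ^ u) / 2 ^ S) * (+ (2 ^ (v ⊓ u) ℕ.* 2 ^ (v ⊓ u)) / (2 ^ u ℕ.* 2 ^ u))
      ≡⟨ cong₂ _*_ (cong₂ _*_ ∣h'0∣≡ ∣h'0∣₂≡) G₂≡ ⟨
    ∣ h'0 a ∣ * abs₂ (h'0 a) * G₂ (h0 a) ∎
    where open ≡-Reasoning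

  sq-g : sq (ℤ→ℚ (g (P a) (Q a))) ≡ d a * abs₂ (h'0 a) * G₂ (h0 a)
  sq-g = begin
    sq (ℤ→ℚ (g (P a) (Q a)))
      ≡⟨ cong (sq ∘ ℤ→ℚ) g≡ ⟩
    sq (+ 2 ^ (v ⊓ u) / 1)
      ≡⟨ sq-g-identity (2 ^ S) (2 ^ u) (2 ^ (v ⊓ u)) ⟩
    + 2 ^ S / 1 * (+ (2 ^ u ℕ.* 2 ^ u) / 2 ^ S) * (+ (2 ^ (v ⊓ u) ℕ.* 2 ^ (v ⊓ u)) / (2 ^ u ℕ.* 2 ^ u))
      ≡⟨ cong₂ _*_ (cong₂ _*_ d≡ ∣h'0∣₂≡) G₂≡ ⟨
    d a * abs₂ (h'0 a) * G₂ (h0 a) ∎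
    where open ≡-Reasoning

proposition1 : (k : ℕ) → 1 ≤ k → (a : Vec ℕ k) →
      (inv (sq (ℤ→ℚ (Q a))) ≡ ∣ h'0 a ∣ * inv (d a))
    × (inv (sq (abs₂ (ℤ→ℚ (Q a)))) ≡ d a * abs₂ (h'0 a))
    × (inv (sq (R (P a) (Q a))) ≡ ∣ h'0 a ∣ * abs₂ (h'0 a) * G₂ (h0 a))
    × (sq (ℤ→ℚ (g (P a) (Q a))) ≡ d a * abs₂ (h'0 a) * G₂ (h0 a))
proposition1 (suc k) _ a@(_ ∷ as) = inv-sq-Q a , inv-sq-∣Q∣₂ a , inv-sq-R a , sq-g a
  where
  -- Pℕ (t ∷ ts) = Qℕ ts, so k ≥ 1 is what makes P nonzero.
  instance _ = Qℕ≢0 as
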